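{- There exists an upper porous set $X\subseteq 2^\omega$ which is not $\sigma$-porous.
   Context: $[\beta]=\{x\in2^\omega:\beta\subseteq x\}$ for finite binary $\beta$; $x\upharpoonright n$ is the restriction of $x$ to $\{0,\dots,n-1\}$. $X\subseteq 2^\omega$ is porous if there exists $k$ such that for every $m$ and every $\alpha\in 2^m$ there is $\beta\in 2^{m+k}$ with $\alpha\subseteq\beta$ and $[\beta]\cap X=\emptyset$. $X$ is $\sigma$-porous if it is a countable union of porous sets. $X$ is upper porous if for every $x\in X$ there exists $K$ such that for infinitely many $n$ there is a finite binary sequence $\beta\supseteq x\upharpoonright n$ with $|\beta|=n+K$ and $[\beta]\cap X=\emptyset$. -}

module Defs where

open import Data.Bool using (Bool)
open import Data.Nat using (ℕ; _+_; _≤_)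
open import Data.Fin using (Fin; toℕ; _↑ˡ_)
open import Data.Vec using (Vec; lookup; tabulate)
open import Data.Product using (Σ; ∃; _×_)
open import Relation.Nullary using (¬_)
open import Function using (_∘_; _⇔_)
open import Relation.Binary.PropositionalEquality using (_≡_)

Cantor : Set
Cantor = ℕ → Bool

Subset : Set₁
Subset = Cantor → Set

_↾_ : Cantor → (n : ℕ) → Vec Bool n
x ↾ n = tabulate (x ∘ toℕ)

_⊑_ : ∀ {m k} → Vec Bool m → Vec Bool (m + k) → Set
_⊑_ {m} {k} α β = (i : Fin m) → lookup α i ≡ lookup β (i ↑ˡ k)


_∈[_] : ∀ {n} → Cantor → Vec Bool n → Set
y ∈[ β ] = (i : Fin _) → lookup β i ≡ y (toℕ i)


DisjointCyl : ∀ {n} → Vec Bool n → Subset → Set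
DisjointCyl β X = (y : Cantor) → y ∈[ β ] → ¬ X y

Porous : Subset → Set
Porous X = ∃ λ (k : ℕ) → (m : ℕ) (α : Vec Bool m) →
  Σ (Vec Bool (m + k)) λ β → (α ⊑ β) × DisjointCyl β X

SigmaPorous : Subset → Set₁
SigmaPorous X = Σ (ℕ → Subset) λ P → ((i : ℕ) → Porous (P i)) ×
  ((x : Cantor) → X x ⇔ ∃ λ (i : ℕ) → P i x)

-- "for infinitely many n" read as: for every m there is n ≥ m
UpperPorous : Subset → Set
UpperPorous X = (x : Cantor) → X x → ∃ λ (K : ℕ) → (m : ℕ) →
  ∃ λ (n : ℕ) → m ≤ n × Σ (Vec Bool (n + K)) λ β → ((x ↾ n) ⊑ β) × DisjointCyl β X

{-# OPTIONS --safe #-}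
module Submission where

open import Defs
open import Data.Bool using (Bool; true; false)
open import Data.Empty using (⊥-elim)
open import Data.Fin using (Fin; toℕ; fromℕ<; _↑ˡ_; _↑ʳ_)
open import Data.Fin.Properties using (toℕ-fromℕ<; toℕ-↑ˡ; toℕ-↑ʳ; toℕ<n)
open import Data.Nat
open import Data.Nat.Properties
open import Data.Product using (Σ; ∃; _×_; _,_; proj₁; proj₂)
open import Data.Sum using (inj₁; inj₂)
open import Data.Vec using (Vec; []; _∷_; _++_; lookup)
open import Data.Vec.Properties using (lookup∘tabulate; lookup-++ˡ; lookup-++ʳ)
open import Function using (Equivalence; _∘′_)
open import Relation.Nullary using (¬_; yes; no)
open import Relation.Binary.PropositionalEquality

-- X is the set of sequences vanishing at the triangular numbers T j.  Appending
-- a 1 at position T m to x ↾ T m leaves X, which gives upper porosity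
-- with constant 1.  The gap between T m and T (m + 1) grows with m, so inside a
-- late enough gap any porosity constant can be spent without leaving X: given
-- porous sets P i one extends finite initial segments step by step, the i-th
-- extension escaping P i inside such a gap, and the limit lies in X but in no P i.

_≈[_]_ : Cantor → ℕ → Cantor → Set
x ≈[ n ] y = ∀ i → i < n → x i ≡ y i

≈-trans : ∀ {n x y z} → x ≈[ n ] y → y ≈[ n ] z → x ≈[ n ] z
≈-trans x≈y y≈z i i<n = trans (x≈y i i<n) (y≈z i i<n)

≈-weaken : ∀ {m n x y} → m ≤ n → x ≈[ n ] y → x ≈[ m ] y
≈-weaken m≤n x≈y i i<m = x≈y i (<-≤-trans i<m m≤n)

padFalse : ∀ {n} → Vec Bool n → Cantor
padFalse []      _       = false
padFalse (b ∷ _) zero    = b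
padFalse (_ ∷ β) (suc i) = padFalse β i

padFalse-lookup : ∀ {n} (β : Vec Bool n) i → padFalse β (toℕ i) ≡ lookup β i
padFalse-lookup (_ ∷ _) Fin.zero    = refl
padFalse-lookup (_ ∷ β) (Fin.suc i) = padFalse-lookup β i

padFalse-beyond : ∀ {n} (β : Vec Bool n) {i} → n ≤ i → padFalse β i ≡ false
padFalse-beyond []      _         = refl
padFalse-beyond (_ ∷ β) (s≤s n≤i) = padFalse-beyond β n≤i

≈padFalse⇒∈[] : ∀ {n} (β : Vec Bool n) z → z ≈[ n ] padFalse β → z ∈[ β ]
≈padFalse⇒∈[] β z z≈β i =
  sym (trans (z≈β (toℕ i) (toℕ<n i)) (padFalse-lookup β i))

⊑⇒padFalse≈ : ∀ {m k} x (β : Vec Bool (m + k)) → (x ↾ m) ⊑ β → padFalse β ≈[ m ] x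
⊑⇒padFalse≈ {m} {k} x β x↾m⊑β n n<m = begin
  padFalse β n                ≡⟨ cong (padFalse β) (sym toℕ[i↑ˡk]≡n) ⟩
  padFalse β (toℕ (i ↑ˡ k))  ≡⟨ padFalse-lookup β (i ↑ˡ k) ⟩
  lookup β (i ↑ˡ k)           ≡⟨ sym (x↾m⊑β i) ⟩
  lookup (x ↾ m) i            ≡⟨ lookup∘tabulate _ i ⟩
  x (toℕ i)                   ≡⟨ cong x (toℕ-fromℕ< n<m) ⟩
  x n                         ∎
  where
  open ≡-Reasoning
  i = fromℕ< n<m
  toℕ[i↑ˡk]≡n : toℕ (i ↑ˡ k) ≡ n
  toℕ[i↑ˡk]≡n = trans (toℕ-↑ˡ i k) (toℕ-fromℕ< n<m)

module Limit (y : ℕ → Cantor) (L : ℕ → ℕ)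
             (L-inc : ∀ i → L i < L (suc i))
             (y-coherent : ∀ i → y (suc i) ≈[ L i ] y i) where

  L-mono : ∀ {i j} → i ≤′ j → L i ≤ L j
  L-mono ≤′-refl        = ≤-refl
  L-mono (≤′-step i≤′j) = ≤-trans (L-mono i≤′j) (<⇒≤ (L-inc _))

  i≤L : ∀ i → i ≤ L i
  i≤L zero    = z≤n
  i≤L (suc i) = <-≤-trans (s≤s (i≤L i)) (L-inc i)

  y-coherent′ : ∀ {i j} → i ≤′ j → y j ≈[ L i ] y i
  y-coherent′ ≤′-refl        _ _ = refl
  y-coherent′ (≤′-step i≤′j) =
    ≈-trans (≈-weaken (L-mono i≤′j) (y-coherent _)) (y-coherent′ i≤′j)

  lim : Cantor
  lim n = y (suc n) n

  lim≈ : ∀ i → lim ≈[ L i ] y i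
  lim≈ i n n<Li with ≤-total i (suc n)
  ... | inj₁ i≤1+n = y-coherent′ (≤⇒≤′ i≤1+n) n n<Li
  ... | inj₂ 1+n≤i = sym (y-coherent′ (≤⇒≤′ 1+n≤i) n (i≤L (suc n)))

ZerosAt : (ℕ → ℕ) → Subset
ZerosAt f x = ∀ j → x (f j) ≡ false

Unbounded : (ℕ → ℕ) → Set
Unbounded f = ∀ m → ∃ λ j → m ≤ f j

LongGaps : (ℕ → ℕ) → Set
LongGaps f = ∀ L k → ∃ λ M → L ≤ M × (∀ j → M ≤ f j → M + k ≤ f j)

zerosAt-upperPorous : ∀ f → Unbounded f → UpperPorous (ZerosAt f)
zerosAt-upperPorous f unbounded x _ = 1 , λ m →
  let (j , m≤fj) = unbounded m in f j , m≤fj , β j , x↾⊑β j , β∩X≡∅ j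
  where
  β : ∀ j → Vec Bool (f j + 1)
  β j = (x ↾ f j) ++ (true ∷ [])

  x↾⊑β : ∀ j → (x ↾ f j) ⊑ β j
  x↾⊑β j i = sym (lookup-++ˡ (x ↾ f j) _ i)

  β-last : ∀ j z → z ∈[ β j ] → z (f j) ≡ true
  β-last j z z∈β = begin
    z (f j)                         ≡⟨ cong z (sym toℕ[last]≡fj) ⟩
    z (toℕ (f j ↑ʳ Fin.zero))       ≡⟨ sym (z∈β (f j ↑ʳ Fin.zero)) ⟩
    lookup (β j) (f j ↑ʳ Fin.zero)  ≡⟨ lookup-++ʳ (x ↾ f j) _ Fin.zero ⟩
    true                            ∎
    where
    open ≡-Reasoning
    toℕ[last]≡fj : toℕ (f j ↑ʳ Fin.zero) ≡ f j
    toℕ[last]≡fj = trans (toℕ-↑ʳ (f j) Fin.zero) (+-identityʳ (f j))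

  β∩X≡∅ : ∀ j → DisjointCyl (β j) (ZerosAt f)
  β∩X≡∅ j z z∈β z∈X with () ← trans (sym (β-last j z z∈β)) (z∈X j)

record Escape (X P : Subset) (L : ℕ) (y : Cantor) : Set where
  field
    L′        : ℕ
    y′        : Cantor
    L<L′      : L < L′
    y′≈y      : y′ ≈[ L ] y
    y′∈X      : X y′
    y′-avoids : ∀ z → z ≈[ L′ ] y′ → ¬ P z

-- The extension is placed in a gap [M, M + K) of f, so it creates no new
-- nonzero value at a position f j.
zerosAt-escape : ∀ {f P} → LongGaps f → Porous P → ∀ L y → ZerosAt f y →
                 Escape (ZerosAt f) P L y
zerosAt-escape {f} {P} longGaps (K , porous) L y y∈X = record
  { L′        = M + K
  ; y′        = padFalse β
  ; L<L′      = <-≤-trans L<M (m≤m+n M K)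
  ; y′≈y      = ≈-weaken (<⇒≤ L<M) β≈y
  ; y′∈X      = β∈X
  ; y′-avoids = λ z z≈β → β∩P≡∅ z (≈padFalse⇒∈[] β z z≈β)
  }
  where
  M = proj₁ (longGaps (suc L) K)
  L<M = proj₁ (proj₂ (longGaps (suc L) K))
  gap = proj₂ (proj₂ (longGaps (suc L) K))
  β = proj₁ (porous M (y ↾ M))
  y↾M⊑β = proj₁ (proj₂ (porous M (y ↾ M)))
  β∩P≡∅ = proj₂ (proj₂ (porous M (y ↾ M)))

  β≈y : padFalse β ≈[ M ] y
  β≈y = ⊑⇒padFalse≈ y β y↾M⊑β

  β∈X : ZerosAt f (padFalse β)
  β∈X j with f j <? M
  ... | yes fj<M = trans (β≈y (f j) fj<M) (y∈X j)
  ... | no  fj≮M = padFalse-beyond β (gap j (≮⇒≥ fj≮M))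

record Stage (X : Subset) : Set where
  constructor stage
  field
    len     : ℕ
    point   : Cantor
    point∈X : X point

zerosAt-avoids-porous : ∀ f → LongGaps f → (P : ℕ → Subset) → (∀ i → Porous (P i)) →
                        ∃ λ x → ZerosAt f x × (∀ i → ¬ P i x)
zerosAt-avoids-porous f longGaps P porous = lim , lim∈X , lim∉P
  where
  escapeAt : ∀ i (s : Stage (ZerosAt f)) → Escape (ZerosAt f) (P i) (Stage.len s) (Stage.point s)
  escapeAt i (stage L y y∈X) = zerosAt-escape longGaps (porous i) L y y∈X

  stages : ℕ → Stage (ZerosAt f)
  stages zero    = stage 0 (λ _ → false) (λ _ → refl)
  stages (suc i) = stage L′ y′ y′∈X
    where open Escape (escapeAt i (stages i))

  open Limit (Stage.point ∘′ stages) (Stage.len ∘′ stages)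
             (λ i → Escape.L<L′ (escapeAt i (stages i)))
             (λ i → Escape.y′≈y (escapeAt i (stages i)))

  lim∈X : ZerosAt f lim
  lim∈X j = Stage.point∈X (stages (suc (f j))) j

  lim∉P : ∀ i → ¬ P i lim
  lim∉P i = Escape.y′-avoids (escapeAt i (stages i)) lim (lim≈ (suc i))

zerosAt-notSigmaPorous : ∀ f → LongGaps f → ¬ SigmaPorous (ZerosAt f)
zerosAt-notSigmaPorous f longGaps (P , porous , X⇔⋃P) =
  let (x , x∈X , x∉P) = zerosAt-avoids-porous f longGaps P porous
      (i , x∈Pi)      = Equivalence.to (X⇔⋃P x) x∈X
  in x∉P i x∈Pi

triangle : ℕ → ℕ
triangle zero    = 0
triangle (suc n) = triangle n + suc n

n≤triangle : ∀ n → n ≤ triangle n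
n≤triangle zero    = z≤n
n≤triangle (suc n) = m≤n+m (suc n) (triangle n)

triangle-mono-≤ : ∀ {m n} → m ≤ n → triangle m ≤ triangle n
triangle-mono-≤ {zero}              _         = z≤n
triangle-mono-≤ {suc m} {suc n} (s≤s m≤n) = +-mono-≤ (triangle-mono-≤ m≤n) (s≤s m≤n)

triangle-cancel-< : ∀ {m n} → triangle m < triangle n → m < n
triangle-cancel-< {m} {n} Tm<Tn with m <? n
... | yes m<n = m<n
... | no  m≮n = ⊥-elim (<⇒≱ Tm<Tn (triangle-mono-≤ (≮⇒≥ m≮n)))

triangle-unbounded : Unbounded triangle
triangle-unbounded m = m , n≤triangle m

-- The gap after triangle (L + k) has length L + k ≥ k.
triangle-longGaps : LongGaps triangle
triangle-longGaps L k = suc (triangle n) , L≤M , gap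
  where
  n = L + k
  L≤M : L ≤ suc (triangle n)
  L≤M = ≤-trans (m≤m+n L k) (≤-trans (n≤triangle n) (n≤1+n _))
  gap : ∀ j → suc (triangle n) ≤ triangle j → suc (triangle n) + k ≤ triangle j
  gap j Tn<Tj = begin
    suc (triangle n) + k     ≤⟨ s≤s (+-monoʳ-≤ (triangle n) (m≤n+m k L)) ⟩
    suc (triangle n + n)     ≡⟨ sym (+-suc (triangle n) n) ⟩
    triangle (suc n)         ≤⟨ triangle-mono-≤ (triangle-cancel-< {n = j} Tn<Tj) ⟩
    triangle j               ∎
    where open ≤-Reasoning

mainTheorem10 : Σ Subset λ X → UpperPorous X × ¬ SigmaPorous X
mainTheorem10 = ZerosAt triangle
              , zerosAt-upperPorous triangle triangle-unbounded
              , zerosAt-notSigmaPorous triangle triangle-longGaps
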